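{- For all implicative-disjunctive formulas $A, B$ and every truth value assignment $V$ with $V(A)=V(B)=F$: $$(\Delta[V;A])^{\sim A},\; (\Delta[V;B])^{\sim B} \vdash_{id} (\Delta[V;A \vee B])^{\sim(A \vee B)}.$$
   Context: **Language.** Formulas are built from the atomic formulas $p_1, p_2, \dots$ using the binary connectives $\to$, $\vee$ and $\&$. Implicative-disjunctive formulas are those without $\&$. Iterated connectives associate to the right. All formulas are arranged in a fixed decidable linear order $R$. **Semantics.** A truth value assignment $V$ maps formulas to $\{T,F\}$ according to the classical truth conditions. **Notation.** - $\Delta[V;A]$ is the set of atomic subformulas $C$ of $A$ with $V(C)=F$. - For a finite set $K$ of formulas with distinct elements $B_1, \dots, B_n$ listed in the order $R$, $(K)^{\sim A}$ is $A$ if $K$ is empty, and $A \to (B_1 \vee \dots \vee B_n)$ otherwise. Here $B_1 \vee \dots \vee B_n$ is right-associated, and is $B_1$ when $n=1$. **Calculus.** $\vdash_{id}$ denotes derivability in the classical implicative-disjunctive propositional calculus. Its axiom schemes are: - $A \to B \to A$; - $(A \to B \to C) \to (A \to B) \to A \to C$; - $((A \to B) \to A) \to A$; - $A \to (A \vee B)$; - $A \to (B \vee A)$; - $(A \to C) \to (B \to C) \to (A \vee B) \to C$. Its only rule is modus ponens. -}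

module Defs where

open import Level using (0ℓ)
open import Data.Nat using (ℕ)
open import Data.Nat.Properties using () renaming (_≟_ to _≟ℕ_)
open import Data.Bool using (Bool; true; false; _∧_; _∨_; not)
open import Data.List using (List; []; _∷_; _++_; filter; deduplicate)
open import Data.List.Membership.Propositional using (_∈_)
open import Data.Product using (_×_; _,_)
open import Data.Empty using (⊥)
open import Data.Unit using (⊤)
open import Relation.Nullary using (Dec; yes; no)
open import Relation.Nullary.Decidable using (map′)
open import Relation.Binary.Core using (Rel)
open import Relation.Binary.Structures using (IsDecTotalOrder)
open import Relation.Binary.Bundles using (DecTotalOrder)
open import Relation.Binary.PropositionalEquality using (_≡_; refl; cong; cong₂)
import Data.List.Sort

infixr 5 _⇒_
infixr 6 _∨̇_
infixr 7 _&̇_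
data Fm : Set where
  atom : ℕ → Fm
  _⇒_  : Fm → Fm → Fm
  _∨̇_  : Fm → Fm → Fm
  _&̇_  : Fm → Fm → Fm

-- implicative-disjunctive formulas: those without &
IsID : Fm → Set
IsID (atom _) = ⊤
IsID (A ⇒ B)  = IsID A × IsID B
IsID (A ∨̇ B)  = IsID A × IsID B
IsID (A &̇ B)  = ⊥

Assignment : Set
Assignment = ℕ → Bool

val : Assignment → Fm → Bool
val v (atom n) = v n
val v (A ⇒ B)  = not (val v A) ∨ val v B
val v (A ∨̇ B)  = val v A ∨ val v B
val v (A &̇ B)  = val v A ∧ val v B

atoms : Fm → List Fm
atoms (atom n) = atom n ∷ []
atoms (A ⇒ B)  = atoms A ++ atoms B
atoms (A ∨̇ B)  = atoms A ++ atoms B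
atoms (A &̇ B)  = atoms A ++ atoms B

atom-inj : ∀ {m n} → atom m ≡ atom n → m ≡ n
atom-inj refl = refl

_≟F_ : (A B : Fm) → Dec (A ≡ B)
atom m ≟F atom n = map′ (cong atom) atom-inj (m ≟ℕ n)
(A ⇒ B) ≟F (C ⇒ D) with A ≟F C | B ≟F D
... | yes refl | yes refl = yes refl
... | no p | _ = no λ { refl → p refl }
... | yes _ | no q = no λ { refl → q refl }
(A ∨̇ B) ≟F (C ∨̇ D) with A ≟F C | B ≟F D
... | yes refl | yes refl = yes refl
... | no p | _ = no λ { refl → p refl }
... | yes _ | no q = no λ { refl → q refl }
(A &̇ B) ≟F (C &̇ D) with A ≟F C | B ≟F D
... | yes refl | yes refl = yes refl
... | no p | _ = no λ { refl → p refl }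
... | yes _ | no q = no λ { refl → q refl }
atom _ ≟F (_ ⇒ _) = no λ ()
atom _ ≟F (_ ∨̇ _) = no λ ()
atom _ ≟F (_ &̇ _) = no λ ()
(_ ⇒ _) ≟F atom _ = no λ ()
(_ ⇒ _) ≟F (_ ∨̇ _) = no λ ()
(_ ⇒ _) ≟F (_ &̇ _) = no λ ()
(_ ∨̇ _) ≟F atom _ = no λ ()
(_ ∨̇ _) ≟F (_ ⇒ _) = no λ ()
(_ ∨̇ _) ≟F (_ &̇ _) = no λ ()
(_ &̇ _) ≟F atom _ = no λ ()
(_ &̇ _) ≟F (_ ⇒ _) = no λ ()
(_ &̇ _) ≟F (_ ∨̇ _) = no λ ()

isFalse? : (v : Assignment) (C : Fm) → Dec (val v C ≡ false)
isFalse? v C = Data.Bool._≟_ (val v C) false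
  where import Data.Bool

module _ (_≤R_ : Rel Fm 0ℓ) (isR : IsDecTotalOrder _≡_ _≤R_) where

  Rbundle : DecTotalOrder 0ℓ 0ℓ 0ℓ
  Rbundle = record { Carrier = Fm ; _≈_ = _≡_ ; _≤_ = _≤R_ ; isDecTotalOrder = isR }

  sortR : List Fm → List Fm
  sortR = Data.List.Sort.sort Rbundle

  Δ : Assignment → Fm → List Fm
  Δ v A = sortR (deduplicate _≟F_ (filter (isFalse? v) (atoms A)))

bigOr : Fm → List Fm → Fm
bigOr B []       = B
bigOr B (C ∷ Cs) = B ∨̇ bigOr C Cs

-- (K)^{∼A} for K given as its list of distinct elements in order R
tilde : List Fm → Fm → Fm
tilde []       A = A
tilde (B ∷ Bs) A = A ⇒ bigOr B Bs

infix 3 _⊢_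
data _⊢_ (Γ : List Fm) : Fm → Set where
  hyp : ∀ {A} → A ∈ Γ → Γ ⊢ A
  ax1 : ∀ {A B} → IsID A → IsID B → Γ ⊢ A ⇒ B ⇒ A
  ax2 : ∀ {A B C} → IsID A → IsID B → IsID C →
        Γ ⊢ (A ⇒ B ⇒ C) ⇒ (A ⇒ B) ⇒ A ⇒ C
  ax3 : ∀ {A B} → IsID A → IsID B → Γ ⊢ ((A ⇒ B) ⇒ A) ⇒ A
  ax4 : ∀ {A B} → IsID A → IsID B → Γ ⊢ A ⇒ (A ∨̇ B)
  ax5 : ∀ {A B} → IsID A → IsID B → Γ ⊢ A ⇒ (B ∨̇ A)
  ax6 : ∀ {A B C} → IsID A → IsID B → IsID C →
        Γ ⊢ (A ⇒ C) ⇒ (B ⇒ C) ⇒ (A ∨̇ B) ⇒ C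
  mp  : ∀ {A B} → Γ ⊢ A ⇒ B → Γ ⊢ A → Γ ⊢ B

-- Every atom falsified by V in A or in B is an atom of A ∨ B falsified by V, so
-- the disjunction of Δ[V;A] (and likewise of Δ[V;B]) implies the disjunction of
-- Δ[V;A ∨ B]. As V(A) = V(B) = F, both sets are nonempty, so the hypotheses really
-- are the implications A → ⋁Δ[V;A] and B → ⋁Δ[V;B], and ∨-elimination combines them.
module Submission where

open import Defs
open import Level using (0ℓ)
open import Data.Bool using (true; false; not)
open import Data.Bool.Properties using (∨-conicalˡ; ∨-conicalʳ)
open import Data.List using (List; []; _∷_; filter)
open import Data.List.Membership.Propositional using (_∈_)
open import Data.List.Membership.Propositional.Properties
  using (∈-++⁺ˡ; ∈-++⁺ʳ; ∈-++⁻; ∈-filter⁺; ∈-filter⁻; ∈-deduplicate⁺; ∈-deduplicate⁻)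
open import Data.List.Relation.Unary.Any using (here; there)
open import Data.List.Relation.Unary.All as All using (All; []; _∷_)
open import Data.List.Relation.Binary.Subset.Propositional using (_⊆_)
open import Data.List.Relation.Binary.Subset.Propositional.Properties using (xs⊆xs++ys; xs⊆ys++xs)
open import Data.List.Relation.Binary.Permutation.Propositional using (↭-sym)
open import Data.List.Relation.Binary.Permutation.Propositional.Properties using (∈-resp-↭)
open import Data.Product using (∃-syntax; _×_; _,_; proj₁; proj₂)
open import Data.Sum using ([_,_]′)
open import Data.Unit using (tt)
open import Function using (_∘_)
open import Relation.Binary.Core using (Rel)
open import Relation.Binary.Structures using (IsDecTotalOrder)
open import Relation.Binary.PropositionalEquality using (_≡_; refl)
import Data.List.Sort

module _ {Γ : List Fm} where

  ⊢-id : ∀ {A} → IsID A → Γ ⊢ A ⇒ A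
  ⊢-id {A} a = mp (mp (ax2 {B = A ⇒ A} a (a , a) a) (ax1 a (a , a))) (ax1 a a)

  ⊢-∘ : ∀ {A B C} → IsID A → IsID B → IsID C →
        Γ ⊢ B ⇒ C → Γ ⊢ A ⇒ B → Γ ⊢ A ⇒ C
  ⊢-∘ a b c bc ab = mp (mp (ax2 a b c) (mp (ax1 (b , c) a) bc)) ab

  ⊢-∨-elim : ∀ {A B C} → IsID A → IsID B → IsID C →
             Γ ⊢ A ⇒ C → Γ ⊢ B ⇒ C → Γ ⊢ A ∨̇ B ⇒ C
  ⊢-∨-elim a b c ac bc = mp (mp (ax6 a b c) ac) bc

bigOr-ID : ∀ {y ys} → All IsID (y ∷ ys) → IsID (bigOr y ys)
bigOr-ID {ys = []}    (iy ∷ [])  = iy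
bigOr-ID {ys = _ ∷ _} (iy ∷ iys) = iy , bigOr-ID iys

∈⇒⊢bigOr : ∀ {Γ C y ys} → All IsID (y ∷ ys) → C ∈ y ∷ ys → Γ ⊢ C ⇒ bigOr y ys
∈⇒⊢bigOr {ys = []}    (iy ∷ [])  (here refl) = ⊢-id iy
∈⇒⊢bigOr {ys = _ ∷ _} (iy ∷ iys) (here refl) = ax4 iy (bigOr-ID iys)
∈⇒⊢bigOr {ys = _ ∷ _} (iy ∷ iys) (there C∈ys) =
  ⊢-∘ (All.lookup iys C∈ys) (bigOr-ID iys) (iy , bigOr-ID iys)
      (ax5 (bigOr-ID iys) iy) (∈⇒⊢bigOr iys C∈ys)

⊆⇒⊢bigOr : ∀ {Γ x xs y ys} → All IsID (x ∷ xs) → All IsID (y ∷ ys) →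
           x ∷ xs ⊆ y ∷ ys → Γ ⊢ bigOr x xs ⇒ bigOr y ys
⊆⇒⊢bigOr {xs = []}    (ix ∷ [])  iys xs⊆ys = ∈⇒⊢bigOr iys (xs⊆ys (here refl))
⊆⇒⊢bigOr {xs = _ ∷ _} (ix ∷ ixs) iys xs⊆ys =
  ⊢-∨-elim ix (bigOr-ID ixs) (bigOr-ID iys)
    (∈⇒⊢bigOr iys (xs⊆ys (here refl))) (⊆⇒⊢bigOr ixs iys (xs⊆ys ∘ there))

tilde-∨ : ∀ {A B a b} {KA KB K : List Fm} → IsID A → IsID B →
          All IsID KA → All IsID KB → All IsID K → KA ⊆ K → KB ⊆ K →
          a ∈ KA → b ∈ KB → tilde KA A ∷ tilde KB B ∷ [] ⊢ tilde K (A ∨̇ B)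
tilde-∨ {KA = []} _ _ _ _ _ _ _ () _
tilde-∨ {KA = _ ∷ _} {KB = []} _ _ _ _ _ _ _ _ ()
tilde-∨ {KA = _ ∷ _} {KB = _ ∷ _} {K = []} _ _ _ _ _ KA⊆K _ _ _ with KA⊆K (here refl)
... | ()
tilde-∨ {KA = _ ∷ _} {KB = _ ∷ _} {K = _ ∷ _} iA iB iKA iKB iK KA⊆K KB⊆K _ _ =
  ⊢-∨-elim iA iB (bigOr-ID iK)
    (⊢-∘ iA (bigOr-ID iKA) (bigOr-ID iK) (⊆⇒⊢bigOr iKA iK KA⊆K) (hyp (here refl)))
    (⊢-∘ iB (bigOr-ID iKB) (bigOr-ID iK) (⊆⇒⊢bigOr iKB iK KB⊆K) (hyp (there (here refl))))

atoms-ID : ∀ A {x} → x ∈ atoms A → IsID x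
atoms-ID (atom n) (here refl) = tt
atoms-ID (A ⇒ B)  x∈ = [ atoms-ID A , atoms-ID B ]′ (∈-++⁻ (atoms A) x∈)
atoms-ID (A ∨̇ B)  x∈ = [ atoms-ID A , atoms-ID B ]′ (∈-++⁻ (atoms A) x∈)
atoms-ID (A &̇ B)  x∈ = [ atoms-ID A , atoms-ID B ]′ (∈-++⁻ (atoms A) x∈)

falsified-atom : ∀ v A → val v A ≡ false → ∃[ x ] x ∈ atoms A × val v x ≡ false
falsified-atom v (atom n) vA = atom n , here refl , vA
falsified-atom v (A ⇒ B) vA⇒B
  with x , x∈B , vx ← falsified-atom v B (∨-conicalʳ (not (val v A)) (val v B) vA⇒B)
  = x , ∈-++⁺ʳ (atoms A) x∈B , vx
falsified-atom v (A ∨̇ B) vA∨B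
  with x , x∈A , vx ← falsified-atom v A (∨-conicalˡ (val v A) (val v B) vA∨B)
  = x , ∈-++⁺ˡ x∈A , vx
falsified-atom v (A &̇ B) vA&B with val v A in vA
... | false with x , x∈A , vx ← falsified-atom v A vA = x , ∈-++⁺ˡ x∈A , vx
... | true  with x , x∈B , vx ← falsified-atom v B vA&B = x , ∈-++⁺ʳ (atoms A) x∈B , vx

module ΔProperties (_≤R_ : Rel Fm 0ℓ) (isR : IsDecTotalOrder _≡_ _≤R_) where
  open Data.List.Sort (Rbundle _≤R_ isR) using (sort-↭)

  ∈Δ⁻ : ∀ v A {x} → x ∈ Δ _≤R_ isR v A → x ∈ atoms A × val v x ≡ false
  ∈Δ⁻ v A x∈ = ∈-filter⁻ (isFalse? v)
    (∈-deduplicate⁻ _≟F_ (filter (isFalse? v) (atoms A)) (∈-resp-↭ (sort-↭ _) x∈))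

  ∈Δ⁺ : ∀ v A {x} → x ∈ atoms A → val v x ≡ false → x ∈ Δ _≤R_ isR v A
  ∈Δ⁺ v A x∈ vx = ∈-resp-↭ (↭-sym (sort-↭ _))
    (∈-deduplicate⁺ _≟F_ (∈-filter⁺ (isFalse? v) x∈ vx))

  Δ-ID : ∀ v A → All IsID (Δ _≤R_ isR v A)
  Δ-ID v A = All.tabulate (atoms-ID A ∘ proj₁ ∘ ∈Δ⁻ v A)

  Δ-mono : ∀ v A C → atoms A ⊆ atoms C → Δ _≤R_ isR v A ⊆ Δ _≤R_ isR v C
  Δ-mono v A C A⊆C x∈ with x∈A , vx ← ∈Δ⁻ v A x∈ = ∈Δ⁺ v C (A⊆C x∈A) vx

  Δ-nonempty : ∀ v A → val v A ≡ false → ∃[ x ] x ∈ Δ _≤R_ isR v A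
  Δ-nonempty v A vA with x , x∈A , vx ← falsified-atom v A vA = x , ∈Δ⁺ v A x∈A vx

mainTheorem16 : (_≤R_ : Rel Fm 0ℓ) (isR : IsDecTotalOrder _≡_ _≤R_)
    (A B : Fm) → IsID A → IsID B → (v : Assignment) →
    val v A ≡ false → val v B ≡ false →
    tilde (Δ _≤R_ isR v A) A ∷ tilde (Δ _≤R_ isR v B) B ∷ []
      ⊢ tilde (Δ _≤R_ isR v (A ∨̇ B)) (A ∨̇ B)
mainTheorem16 _≤R_ isR A B iA iB v vA vB =
  tilde-∨ iA iB (Δ-ID v A) (Δ-ID v B) (Δ-ID v (A ∨̇ B))
    (Δ-mono v A (A ∨̇ B) (xs⊆xs++ys (atoms A) (atoms B)))
    (Δ-mono v B (A ∨̇ B) (xs⊆ys++xs (atoms B) (atoms A)))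
    (proj₂ (Δ-nonempty v A vA)) (proj₂ (Δ-nonempty v B vB))
  where open ΔProperties _≤R_ isR
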